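{- Let $p:\mathbb E\to\mathbb B$ be a fibration, $\mathcal T=(T,\eta,\mu)$ a monad on $\mathbb B$, and $R:\mathbb A\to\mathbb B_{\mathcal T}$, $S:\mathbb A\to\mathbb E$ a lifting parameter for $\mathcal T$ such that $(p,S)$ satisfies the codensity condition. Then the codensity lifting $\mathcal T^{\top\top}=(T^{\top\top},\eta^{\top\top},\mu^{\top\top})$ (constructed as in the context) is a monad on $\mathbb E$ and is a lifting of $\mathcal T$ along $p$.
   Context: Notation: juxtaposition denotes whiskering of functors and natural transformations, $\bullet$ vertical composition. Let $J\dashv K$, $J:\mathbb B\to\mathbb B_{\mathcal T}$, $K:\mathbb B_{\mathcal T}\to\mathbb B$ be the Kleisli resolution of $\mathcal T$ with counit $\epsilon:JK\to\mathrm{Id}$ (so $KJ=T$). A lifting of $\mathcal T$ along $p$ is a monad $(\dot T,\dot\eta,\dot\mu)$ on $\mathbb E$ with $p\dot T=Tp$, $p\dot\eta=\eta p$, $p\dot\mu=\mu p$ (no fibredness is required). A lifting parameter is a span of functors $R:\mathbb A\to\mathbb B_{\mathcal T}$, $S:\mathbb A\to\mathbb E$ with $KR=pS$. $(p,S)$ satisfies the codensity condition if a right Kan extension $(\mathrm{Ran}_SS,c:(\mathrm{Ran}_SS)S\to S)$ exists and $p$ preserves it. Then $\mathrm{Ran}_SS$ is the codensity monad with unit $u:\mathrm{Id}\to\mathrm{Ran}_SS$ and multiplication $m$ the unique natural transformations with $c\bullet uS=\mathrm{id}_S$ and $c\bullet mS=c\bullet(\mathrm{Ran}_SS)c$. Since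 $p$ preserves the Kan extension, for each $H:\mathbb E\to\mathbb B$ the map $\beta\mapsto pc\bullet\beta S$ is a bijection from natural transformations $H\to p\,\mathrm{Ran}_SS$ to natural transformations $HS\to pS$; write $\overline{(-)}$ for its inverse. Codensity lifting: regard $K\epsilon R$ as a natural transformation $TpS=KJKR\to KR=pS$, giving $\overline{K\epsilon R}:Tp\to p\,\mathrm{Ran}_SS$. Let $\sigma:T^{\top\top}\to\mathrm{Ran}_SS$ be a cartesian lifting of $\overline{K\epsilon R}$ with respect to the fibration $[\mathbb E,p]:[\mathbb E,\mathbb E]\to[\mathbb E,\mathbb B]$ (postcomposition with $p$), so $pT^{\top\top}=Tp$. Let $\eta^{\top\top}:\mathrm{Id}\to T^{\top\top}$ be the unique natural transformation above $\eta p$ with $\sigma\bullet\eta^{\top\top}=u$, and $\mu^{\top\top}:T^{\top\top}T^{\top\top}\to T^{\top\top}$ the unique natural transformation above $\mu p$ with $\sigma\bullet\mu^{\top\top}=m\bullet\sigma(\mathrm{Ran}_SS)\bullet T^{\top\top}\sigma$ (these exist by cartesianness of $\sigma$). -}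

module Defs where

open import Level using (Level; _⊔_) renaming (suc to lsuc)
open import Data.Product using (Σ; _×_; _,_; proj₁; proj₂)
open import Relation.Binary.PropositionalEquality
  using (_≡_; refl; sym; trans; cong; cong₂; module ≡-Reasoning)

private
  variable
    o ℓ o' ℓ' o'' ℓ'' o₃ ℓ₃ : Level

record Category (o ℓ : Level) : Set (lsuc (o ⊔ ℓ)) where
  infixr 9 _∘_
  field
    Obj : Set o
    Hom : Obj → Obj → Set ℓ
    id  : ∀ {A} → Hom A A
    _∘_ : ∀ {A B C} → Hom B C → Hom A B → Hom A C
    identityˡ : ∀ {A B} {f : Hom A B} → id ∘ f ≡ f
    identityʳ : ∀ {A B} {f : Hom A B} → f ∘ id ≡ f
    assoc : ∀ {A B C D} {f : Hom A B} {g : Hom B C} {h : Hom C D} →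
            (h ∘ g) ∘ f ≡ h ∘ (g ∘ f)

  ≡⇒Hom : ∀ {A B} → A ≡ B → Hom A B
  ≡⇒Hom refl = id

  id-comm : ∀ {A B} (f : Hom A B) → id ∘ f ≡ f ∘ id
  id-comm f = trans identityˡ (sym identityʳ)

open Category public using (Obj; Hom)

record Functor (C : Category o ℓ) (D : Category o' ℓ') : Set (o ⊔ ℓ ⊔ o' ⊔ ℓ') where
  private
    module C = Category C
    module D = Category D
  field
    F₀ : C.Obj → D.Obj
    F₁ : ∀ {A B} → C.Hom A B → D.Hom (F₀ A) (F₀ B)
    identity : ∀ {A} → F₁ (C.id {A}) ≡ D.id
    homomorphism : ∀ {A B E} {f : C.Hom A B} {g : C.Hom B E} →
                   F₁ (g C.∘ f) ≡ F₁ g D.∘ F₁ f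

open Functor public

idF : {C : Category o ℓ} → Functor C C
idF = record { F₀ = λ X → X ; F₁ = λ f → f ; identity = refl ; homomorphism = refl }

infixr 9 _∘F_
_∘F_ : {C : Category o ℓ} {D : Category o' ℓ'} {E : Category o'' ℓ''} →
       Functor D E → Functor C D → Functor C E
_∘F_ {E = E} G F = record
  { F₀ = λ X → F₀ G (F₀ F X)
  ; F₁ = λ f → F₁ G (F₁ F f)
  ; identity = trans (cong (F₁ G) (identity F)) (identity G)
  ; homomorphism = trans (cong (F₁ G) (homomorphism F)) (homomorphism G)
  }

record NatTrans {C : Category o ℓ} {D : Category o' ℓ'} (F G : Functor C D)
       : Set (o ⊔ ℓ ⊔ o' ⊔ ℓ') where
  private
    module C = Category C
    module D = Category D
  field
    η : ∀ X → D.Hom (F₀ F X) (F₀ G X)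
    commute : ∀ {X Y} (f : C.Hom X Y) → η Y D.∘ F₁ F f ≡ F₁ G f D.∘ η X

open NatTrans public

module _ {C : Category o ℓ} {D : Category o' ℓ'} where
  private
    module D = Category D

  infix 4 _≈N_
  _≈N_ : {F G : Functor C D} → NatTrans F G → NatTrans F G → Set (o ⊔ ℓ')
  α ≈N β = ∀ X → η α X ≡ η β X

  idN : {F : Functor C D} → NatTrans F F
  idN {F} = record { η = λ _ → D.id ; commute = λ f → D.id-comm (F₁ F f) }

  infixr 9 _∘ᵥ_
  _∘ᵥ_ : {F G H : Functor C D} → NatTrans G H → NatTrans F G → NatTrans F H
  _∘ᵥ_ {F} {G} {H} β α = record
    { η = λ X → η β X D.∘ η α X
    ; commute = λ {X} {Y} f → begin
        (η β Y D.∘ η α Y) D.∘ F₁ F f   ≡⟨ D.assoc ⟩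
        η β Y D.∘ (η α Y D.∘ F₁ F f)   ≡⟨ cong (η β Y D.∘_) (commute α f) ⟩
        η β Y D.∘ (F₁ G f D.∘ η α X)   ≡⟨ sym D.assoc ⟩
        (η β Y D.∘ F₁ G f) D.∘ η α X   ≡⟨ cong (D._∘ η α X) (commute β f) ⟩
        (F₁ H f D.∘ η β X) D.∘ η α X   ≡⟨ D.assoc ⟩
        F₁ H f D.∘ (η β X D.∘ η α X)   ∎
    }
    where open ≡-Reasoning

-- whiskering: H ▸ α  (written Hα in the paper) and α ◂ K (written αK)
infixr 10 _▸_
_▸_ : {C : Category o ℓ} {D : Category o' ℓ'} {E : Category o'' ℓ''}
      {F G : Functor C D} (H : Functor D E) → NatTrans F G → NatTrans (H ∘F F) (H ∘F G)
_▸_ {E = E} {F} {G} H α = record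
  { η = λ X → F₁ H (η α X)
  ; commute = λ f → trans (sym (homomorphism H))
                   (trans (cong (F₁ H) (commute α f)) (homomorphism H))
  }

infixl 10 _◂_
_◂_ : {C : Category o ℓ} {D : Category o' ℓ'} {E : Category o'' ℓ''}
      {F G : Functor D E} → NatTrans F G → (K : Functor C D) → NatTrans (F ∘F K) (G ∘F K)
α ◂ K = record { η = λ X → η α (F₀ K X) ; commute = λ f → commute α (F₁ K f) }

record FEq {C : Category o ℓ} {D : Category o' ℓ'} (F G : Functor C D)
       : Set (o ⊔ ℓ ⊔ o' ⊔ ℓ') where
  private
    module C = Category C
    module D = Category D
  field
    eq₀ : ∀ X → F₀ F X ≡ F₀ G X
    eq₁ : ∀ {X Y} (f : C.Hom X Y) →
          D.≡⇒Hom (eq₀ Y) D.∘ F₁ F f ≡ F₁ G f D.∘ D.≡⇒Hom (eq₀ X)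

open FEq public

module _ {C : Category o ℓ} {D : Category o' ℓ'} where
  private
    module D = Category D

  FEq⇒ : {F G : Functor C D} → FEq F G → NatTrans F G
  FEq⇒ e = record { η = λ X → D.≡⇒Hom (eq₀ e X) ; commute = eq₁ e }

  private
    sym-lemma : ∀ {a b a' b'} (e₁ : a ≡ a') (e₂ : b ≡ b')
                (f : D.Hom a b) (g : D.Hom a' b') →
                D.≡⇒Hom e₂ D.∘ f ≡ g D.∘ D.≡⇒Hom e₁ →
                D.≡⇒Hom (sym e₂) D.∘ g ≡ f D.∘ D.≡⇒Hom (sym e₁)
    sym-lemma refl refl f g h =
      trans D.identityˡ (trans (sym D.identityʳ)
        (trans (sym h) (trans D.identityˡ (sym D.identityʳ))))

  FEq-sym : {F G : Functor C D} → FEq F G → FEq G F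
  FEq-sym {F} {G} e = record
    { eq₀ = λ X → sym (eq₀ e X)
    ; eq₁ = λ {X} {Y} f → sym-lemma (eq₀ e X) (eq₀ e Y) (F₁ F f) (F₁ G f) (eq₁ e f)
    }

record IsMonad {C : Category o ℓ} (T : Functor C C)
       (unit : NatTrans idF T) (mult : NatTrans (T ∘F T) T) : Set (o ⊔ ℓ) where
  private
    module C = Category C
  field
    identityˡ : ∀ X → η mult X C.∘ F₁ T (η unit X) ≡ C.id
    identityʳ : ∀ X → η mult X C.∘ η unit (F₀ T X) ≡ C.id
    assoc     : ∀ X → η mult X C.∘ F₁ T (η mult X)
                      ≡ η mult X C.∘ η mult (F₀ T X)

record Monad (C : Category o ℓ) : Set (o ⊔ ℓ) where
  field
    T : Functor C C
    unit : NatTrans idF T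
    mult : NatTrans (T ∘F T) T
    isMonad : IsMonad T unit mult

module Kleisli {C : Category o ℓ} (M : Monad C) where
  private
    module C = Category C
    open Monad M
    open IsMonad isMonad
    T₀ = F₀ T
    T₁ : ∀ {A B} → C.Hom A B → C.Hom (T₀ A) (T₀ B)
    T₁ = F₁ T
    ηc = NatTrans.η unit
    μc = NatTrans.η mult
    open ≡-Reasoning

    assoc² : ∀ {A B C' D E} {f : C.Hom A B} {g : C.Hom B C'} {h : C.Hom C' D} {k : C.Hom D E} →
             ((k C.∘ h) C.∘ g) C.∘ f ≡ k C.∘ (h C.∘ (g C.∘ f))
    assoc² = trans C.assoc C.assoc

    kl-idˡ : ∀ {A B} (f : C.Hom A (T₀ B)) → (μc B C.∘ T₁ (ηc B)) C.∘ f ≡ f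
    kl-idˡ {B = B} f = trans (cong (C._∘ f) (identityˡ B)) C.identityˡ

    kl-idʳ : ∀ {A B} (f : C.Hom A (T₀ B)) → (μc B C.∘ T₁ f) C.∘ ηc A ≡ f
    kl-idʳ {A} {B} f = begin
      (μc B C.∘ T₁ f) C.∘ ηc A        ≡⟨ C.assoc ⟩
      μc B C.∘ (T₁ f C.∘ ηc A)        ≡⟨ cong (μc B C.∘_) (sym (NatTrans.commute unit f)) ⟩
      μc B C.∘ (ηc (T₀ B) C.∘ f)      ≡⟨ sym C.assoc ⟩
      (μc B C.∘ ηc (T₀ B)) C.∘ f      ≡⟨ cong (C._∘ f) (identityʳ B) ⟩
      C.id C.∘ f                      ≡⟨ C.identityˡ ⟩
      f ∎

    kl-ext : ∀ {B C' D} (g : C.Hom B (T₀ C')) (h : C.Hom C' (T₀ D)) →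
             μc D C.∘ T₁ ((μc D C.∘ T₁ h) C.∘ g)
             ≡ (μc D C.∘ T₁ h) C.∘ (μc C' C.∘ T₁ g)
    kl-ext {B} {C'} {D} g h = begin
      μc D C.∘ T₁ ((μc D C.∘ T₁ h) C.∘ g)
        ≡⟨ cong (μc D C.∘_) (trans (homomorphism T) (cong (C._∘ T₁ g) (homomorphism T))) ⟩
      μc D C.∘ ((T₁ (μc D) C.∘ T₁ (T₁ h)) C.∘ T₁ g)
        ≡⟨ sym (trans C.assoc (cong (μc D C.∘_) refl)) ⟩
      (μc D C.∘ (T₁ (μc D) C.∘ T₁ (T₁ h))) C.∘ T₁ g
        ≡⟨ cong (C._∘ T₁ g) (sym C.assoc) ⟩
      ((μc D C.∘ T₁ (μc D)) C.∘ T₁ (T₁ h)) C.∘ T₁ g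
        ≡⟨ cong (λ z → (z C.∘ T₁ (T₁ h)) C.∘ T₁ g) (assoc D) ⟩
      ((μc D C.∘ μc (T₀ D)) C.∘ T₁ (T₁ h)) C.∘ T₁ g
        ≡⟨ cong (C._∘ T₁ g) C.assoc ⟩
      (μc D C.∘ (μc (T₀ D) C.∘ T₁ (T₁ h))) C.∘ T₁ g
        ≡⟨ cong (λ z → (μc D C.∘ z) C.∘ T₁ g) (NatTrans.commute mult h) ⟩
      (μc D C.∘ (T₁ h C.∘ μc C')) C.∘ T₁ g
        ≡⟨ cong (C._∘ T₁ g) (sym C.assoc) ⟩
      ((μc D C.∘ T₁ h) C.∘ μc C') C.∘ T₁ g
        ≡⟨ C.assoc ⟩
      (μc D C.∘ T₁ h) C.∘ (μc C' C.∘ T₁ g) ∎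

  Kl : Category o ℓ
  Kl = record
    { Obj = C.Obj
    ; Hom = λ A B → C.Hom A (T₀ B)
    ; id = λ {A} → ηc A
    ; _∘_ = λ {A} {B} {D} g f → (μc D C.∘ T₁ g) C.∘ f
    ; identityˡ = λ {A} {B} {f} → kl-idˡ f
    ; identityʳ = λ {A} {B} {f} → kl-idʳ f
    ; assoc = λ {A} {B} {C'} {D} {f} {g} {h} → begin
        (μc D C.∘ T₁ ((μc D C.∘ T₁ h) C.∘ g)) C.∘ f
          ≡⟨ cong (C._∘ f) (kl-ext g h) ⟩
        ((μc D C.∘ T₁ h) C.∘ (μc C' C.∘ T₁ g)) C.∘ f
          ≡⟨ C.assoc ⟩
        (μc D C.∘ T₁ h) C.∘ ((μc C' C.∘ T₁ g) C.∘ f) ∎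
    }

  private
    module Kl = Category Kl

  J : Functor C Kl
  J = record
    { F₀ = λ X → X
    ; F₁ = λ {A} {B} f → ηc B C.∘ f
    ; identity = C.identityʳ
    ; homomorphism = λ {A} {B} {E} {f} {g} → sym (begin
        (μc E C.∘ T₁ (ηc E C.∘ g)) C.∘ (ηc B C.∘ f)
          ≡⟨ sym C.assoc ⟩
        ((μc E C.∘ T₁ (ηc E C.∘ g)) C.∘ ηc B) C.∘ f
          ≡⟨ cong (C._∘ f) (kl-idʳ (ηc E C.∘ g)) ⟩
        (ηc E C.∘ g) C.∘ f
          ≡⟨ C.assoc ⟩
        ηc E C.∘ (g C.∘ f) ∎)
    }

  K : Functor Kl C
  K = record
    { F₀ = T₀
    ; F₁ = λ {A} {B} f → μc B C.∘ T₁ f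
    ; identity = λ {A} → identityˡ A
    ; homomorphism = λ {A} {B} {E} {f} {g} → kl-ext f g
    }

  -- counit ε : JK → Id (component at X is id_{TX}, viewed as TX → X in B_T)
  ε : NatTrans (J ∘F K) idF
  ε = record
    { η = λ X → C.id
    ; commute = λ {X} {Y} f → begin
        (μc Y C.∘ T₁ C.id) C.∘ (ηc (T₀ Y) C.∘ (μc Y C.∘ T₁ f))
          ≡⟨ cong (λ z → (μc Y C.∘ z) C.∘ (ηc (T₀ Y) C.∘ (μc Y C.∘ T₁ f))) (identity T) ⟩
        (μc Y C.∘ C.id) C.∘ (ηc (T₀ Y) C.∘ (μc Y C.∘ T₁ f))
          ≡⟨ cong (C._∘ (ηc (T₀ Y) C.∘ (μc Y C.∘ T₁ f))) C.identityʳ ⟩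
        μc Y C.∘ (ηc (T₀ Y) C.∘ (μc Y C.∘ T₁ f))
          ≡⟨ sym C.assoc ⟩
        (μc Y C.∘ ηc (T₀ Y)) C.∘ (μc Y C.∘ T₁ f)
          ≡⟨ cong (C._∘ (μc Y C.∘ T₁ f)) (identityʳ Y) ⟩
        C.id C.∘ (μc Y C.∘ T₁ f)
          ≡⟨ C.identityˡ ⟩
        μc Y C.∘ T₁ f
          ≡⟨ sym C.identityʳ ⟩
        (μc Y C.∘ T₁ f) C.∘ C.id ∎
    }

  -- KJ = T (equal on objects definitionally, on morphisms by the unit law)
  KJ≡T : FEq T (K ∘F J)
  KJ≡T = record
    { eq₀ = λ X → refl
    ; eq₁ = λ {X} {Y} f → begin
        C.id C.∘ T₁ f                   ≡⟨ C.identityˡ ⟩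
        T₁ f                            ≡⟨ sym (kl-idˡ (T₁ f)) ⟩
        (μc Y C.∘ T₁ (ηc Y)) C.∘ T₁ f   ≡⟨ C.assoc ⟩
        μc Y C.∘ (T₁ (ηc Y) C.∘ T₁ f)   ≡⟨ cong (μc Y C.∘_) (sym (homomorphism T)) ⟩
        μc Y C.∘ T₁ (ηc Y C.∘ f)        ≡⟨ sym C.identityʳ ⟩
        (μc Y C.∘ T₁ (ηc Y C.∘ f)) C.∘ C.id ∎
    }

module _ {E : Category o ℓ} {B : Category o' ℓ'} (p : Functor E B) where
  private
    module E = Category E
    module B = Category B

  IsCartesian : ∀ {Z X} → E.Hom Z X → Set (o ⊔ ℓ ⊔ ℓ')
  IsCartesian {Z} {X} g =
    ∀ {W} (h : E.Hom W X) (k : B.Hom (F₀ p W) (F₀ p Z)) →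
    F₁ p g B.∘ k ≡ F₁ p h →
    Σ (E.Hom W Z) λ l → (F₁ p l ≡ k) × (g E.∘ l ≡ h) ×
      (∀ (l' : E.Hom W Z) → F₁ p l' ≡ k → g E.∘ l' ≡ h → l' ≡ l)

  IsFibration : Set (o ⊔ ℓ ⊔ o' ⊔ ℓ')
  IsFibration =
    ∀ {Y X} (f : B.Hom Y (F₀ p X)) →
    Σ E.Obj λ Z → Σ (F₀ p Z ≡ Y) λ e → Σ (E.Hom Z X) λ g →
      IsCartesian g × (F₁ p g ≡ f B.∘ B.≡⇒Hom e)

-- A natural transformation σ : G → H (in [E,E]) is cartesian with respect to
-- the functor [E,p] : [E,E] → [E,B] (postcomposition with p).
IsCartesianNT : {E : Category o ℓ} {B : Category o' ℓ'} (p : Functor E B)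
                {G H : Functor E E} → NatTrans G H → Set (o ⊔ ℓ ⊔ o' ⊔ ℓ')
IsCartesianNT {E = E} p {G} {H} σ =
  ∀ (F : Functor E E) (τ : NatTrans F H) (h : NatTrans (p ∘F F) (p ∘F G)) →
  (p ▸ σ) ∘ᵥ h ≈N p ▸ τ →
  Σ (NatTrans F G) λ θ → (p ▸ θ ≈N h) × (σ ∘ᵥ θ ≈N τ) ×
    (∀ (θ' : NatTrans F G) → p ▸ θ' ≈N h → σ ∘ᵥ θ' ≈N τ → θ' ≈N θ)

IsRan : {A : Category o ℓ} {C : Category o' ℓ'} {D : Category o'' ℓ''}
        (K : Functor A C) (F : Functor A D) (R : Functor C D)
        (c : NatTrans (R ∘F K) F) → Set (o ⊔ ℓ ⊔ o' ⊔ ℓ' ⊔ o'' ⊔ ℓ'')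
IsRan K F R c =
  ∀ (G : Functor _ _) (α : NatTrans (G ∘F K) F) →
  Σ (NatTrans G R) λ β → (c ∘ᵥ (β ◂ K) ≈N α) ×
    (∀ (β' : NatTrans G R) → c ∘ᵥ (β' ◂ K) ≈N α → β' ≈N β)

module _ {C : Category o ℓ} {D : Category o' ℓ'} {E : Category o'' ℓ''}
         {X : Category o₃ ℓ₃} where
  private
    module X = Category X
  assocF : (F : Functor E X) (G : Functor D E) (H : Functor C D) →
           FEq ((F ∘F G) ∘F H) (F ∘F (G ∘F H))
  assocF F G H = record { eq₀ = λ _ → refl ; eq₁ = λ f → X.id-comm _ }

module _ {C : Category o ℓ} {D : Category o' ℓ'} where
  private
    module D = Category D
  unitˡF : (F : Functor C D) → FEq (idF ∘F F) F
  unitˡF F = record { eq₀ = λ _ → refl ; eq₁ = λ f → D.id-comm _ }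
  unitʳF : (F : Functor C D) → FEq F (F ∘F idF)
  unitʳF F = record { eq₀ = λ _ → refl ; eq₁ = λ f → D.id-comm _ }

module Codensity {A : Category o ℓ} {E : Category o' ℓ'}
         (S : Functor A E) (Ran : Functor E E) (c : NatTrans (Ran ∘F S) S)
         (isRan : IsRan S S Ran c) where

  u : NatTrans idF Ran
  u = proj₁ (isRan idF (FEq⇒ (unitˡF S)))

  m : NatTrans (Ran ∘F Ran) Ran
  m = proj₁ (isRan (Ran ∘F Ran) (c ∘ᵥ (Ran ▸ c) ∘ᵥ FEq⇒ (assocF Ran Ran S)))

module Preserved {A : Category o ℓ} {E : Category o' ℓ'} {B : Category o'' ℓ''}
         (p : Functor E B) (S : Functor A E) (Ran : Functor E E)
         (c : NatTrans (Ran ∘F S) S) where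

  pc : NatTrans ((p ∘F Ran) ∘F S) (p ∘F S)
  pc = (p ▸ c) ∘ᵥ FEq⇒ (assocF p Ran S)

  Preserves : Set (o ⊔ ℓ ⊔ o' ⊔ ℓ' ⊔ o'' ⊔ ℓ'')
  Preserves = IsRan S (p ∘F S) (p ∘F Ran) pc

  -- the inverse (-)‾ of  β ↦ pc • βS
  overline : Preserves → {H : Functor E B} →
             NatTrans (H ∘F S) (p ∘F S) → NatTrans H (p ∘F Ran)
  overline pres {H} α = proj₁ (pres H α)

module KεR {A : Category o ℓ} {B : Category o' ℓ'} {E : Category o'' ℓ''}
         (M : Monad B) (p : Functor E B)
         (R : Functor A (Kleisli.Kl M)) (S : Functor A E)
         (KR=pS : FEq (Kleisli.K M ∘F R) (p ∘F S)) where
  open Kleisli M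
  private
    module B = Category B
    T = Monad.T M

  KεR : NatTrans ((K ∘F J) ∘F (K ∘F R)) (K ∘F R)
  KεR = FEq⇒ (record { eq₀ = λ _ → refl ; eq₁ = λ f → B.id-comm _ })
        ∘ᵥ (K ▸ (ε ◂ R))
        ∘ᵥ FEq⇒ (record { eq₀ = λ _ → refl ; eq₁ = λ f → B.id-comm _ })

  -- the same, regarded as T p S → p S using KR = pS and KJ = T
  KεR' : NatTrans ((T ∘F p) ∘F S) (p ∘F S)
  KεR' = FEq⇒ KR=pS ∘ᵥ KεR ∘ᵥ (FEq⇒ KJ≡T ◂ (K ∘F R)) ∘ᵥ (T ▸ FEq⇒ (FEq-sym KR=pS))
         ∘ᵥ FEq⇒ (assocF T p S)

module _ {E : Category o ℓ} {B : Category o' ℓ'} (M : Monad B)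
         (p : Functor E B) (T' : Functor E E) (pT'=Tp : FEq (p ∘F T') (Monad.T M ∘F p)) where
  private
    module B = Category B
    T = Monad.T M

  pT'T'=TTp : ∀ X → B.Hom (F₀ p (F₀ T' (F₀ T' X))) (F₀ T (F₀ T (F₀ p X)))
  pT'T'=TTp X = F₁ T (B.≡⇒Hom (eq₀ pT'=Tp X)) B.∘ B.≡⇒Hom (eq₀ pT'=Tp (F₀ T' X))

  UnitOver : NatTrans idF T' → Set (o ⊔ ℓ')
  UnitOver η' = ∀ X → B.≡⇒Hom (eq₀ pT'=Tp X) B.∘ F₁ p (η η' X) ≡ η (Monad.unit M) (F₀ p X)

  MultOver : NatTrans (T' ∘F T') T' → Set (o ⊔ ℓ')
  MultOver μ' = ∀ X → B.≡⇒Hom (eq₀ pT'=Tp X) B.∘ F₁ p (η μ' X)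
                      ≡ η (Monad.mult M) (F₀ p X) B.∘ pT'T'=TTp X

record IsLifting {E : Category o ℓ} {B : Category o' ℓ'} (M : Monad B)
       (p : Functor E B) (T' : Functor E E)
       (η' : NatTrans idF T') (μ' : NatTrans (T' ∘F T') T') : Set (o ⊔ ℓ ⊔ o' ⊔ ℓ') where
  field
    pT'=Tp : FEq (p ∘F T') (Monad.T M ∘F p)
    η-over : UnitOver M p T' pT'=Tp η'
    μ-over : MultOver M p T' pT'=Tp μ'

-- The monad laws for (T^⊤⊤, η^⊤⊤, μ^⊤⊤) are equations between natural
-- transformations into T^⊤⊤, and since σ is cartesian for [E,p] two such
-- transformations agree as soon as their images under p and their composites
-- with σ agree. Under p the laws become those of T, because η^⊤⊤ and μ^⊤⊤ lie
-- above η and μ; after σ they become those of the codensity monad, because σ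
-- commutes with units and multiplications. The codensity monad laws hold since
-- a transformation into Ran_S S is determined by its composite with c.

module Submission where

open import Level using (Level)
open import Data.Product using (_×_; _,_; proj₁; proj₂)
open import Relation.Binary.PropositionalEquality
  using (_≡_; refl; sym; trans; cong; module ≡-Reasoning)
open import Defs

private
  variable
    o ℓ o' ℓ' o'' ℓ'' o₃ ℓ₃ : Level

module CategoryReasoning (C : Category o ℓ) where
  open Category C hiding (Obj; Hom)

  pullˡ : ∀ {W X Y Z : Obj C} {a : Hom C Y Z} {b : Hom C X Y} {c : Hom C X Z} {f : Hom C W X} →
          a ∘ b ≡ c → a ∘ (b ∘ f) ≡ c ∘ f
  pullˡ {f = f} ab=c = trans (sym assoc) (cong (_∘ f) ab=c)

  pushˡ : ∀ {W X Y Z : Obj C} {a : Hom C Y Z} {b : Hom C X Y} {c : Hom C X Z} {f : Hom C W X} →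
          c ≡ a ∘ b → c ∘ f ≡ a ∘ (b ∘ f)
  pushˡ {f = f} c=ab = trans (cong (_∘ f) c=ab) assoc

  ≡⇒Hom-cancelˡ : ∀ {X Y Z : Obj C} (e : Y ≡ Z) {f g : Hom C X Y} →
                  ≡⇒Hom e ∘ f ≡ ≡⇒Hom e ∘ g → f ≡ g
  ≡⇒Hom-cancelˡ refl ef=eg = trans (sym identityˡ) (trans ef=eg identityˡ)

-- idF ∘F F and (F ∘F G) ∘F H differ from F and F ∘F (G ∘F H) only in their
-- proof fields, so a transformation out of one is one out of the other.
dom-unitˡ : {C : Category o ℓ} {D : Category o' ℓ'} {F G : Functor C D} →
            NatTrans (idF ∘F F) G → NatTrans F G
dom-unitˡ α = record { η = η α ; commute = commute α }

dom-assoc : {C : Category o ℓ} {D : Category o' ℓ'} {X : Category o'' ℓ''} {Y : Category o₃ ℓ₃}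
            {F : Functor Y D} {G : Functor X Y} {H : Functor C X} {K : Functor C D} →
            NatTrans ((F ∘F G) ∘F H) K → NatTrans (F ∘F (G ∘F H)) K
dom-assoc α = record { η = η α ; commute = commute α }

ran-unique : {A : Category o ℓ} {C : Category o' ℓ'} {D : Category o'' ℓ''}
             {K : Functor A C} {F : Functor A D} {R : Functor C D}
             (c : NatTrans (R ∘F K) F) → IsRan K F R c →
             {G : Functor C D} (β β' : NatTrans G R) →
             c ∘ᵥ (β ◂ K) ≈N c ∘ᵥ (β' ◂ K) → β ≈N β'
ran-unique c isRan {G} β β' cβ=cβ' X with isRan G (c ∘ᵥ (β' ◂ _))
... | _ , _ , unique = trans (unique β cβ=cβ' X) (sym (unique β' (λ _ → refl) X))

cartesian-unique : {E : Category o ℓ} {B : Category o' ℓ'} (p : Functor E B)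
                   {G H : Functor E E} (σ : NatTrans G H) → IsCartesianNT p σ →
                   {F : Functor E E} (θ θ' : NatTrans F G) →
                   p ▸ θ ≈N p ▸ θ' → σ ∘ᵥ θ ≈N σ ∘ᵥ θ' → θ ≈N θ'
cartesian-unique p σ cart {F} θ θ' pθ=pθ' σθ=σθ' X
  with cart F (σ ∘ᵥ θ') (p ▸ θ') (λ _ → sym (homomorphism p))
... | _ , _ , _ , unique =
  trans (unique θ pθ=pθ' σθ=σθ' X) (sym (unique θ' (λ _ → refl) (λ _ → refl) X))

module CodensityMonad {A : Category o ℓ} {E : Category o' ℓ'}
         (S : Functor A E) (Ran : Functor E E) (c : NatTrans (Ran ∘F S) S)
         (isRan : IsRan S S Ran c) where
  open Codensity S Ran c isRan
  open Category E hiding (Obj; Hom)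
  open CategoryReasoning E
  open ≡-Reasoning

  c∘uS : ∀ X → η c X ∘ η u (F₀ S X) ≡ id
  c∘uS = proj₁ (proj₂ (isRan idF (FEq⇒ (unitˡF S))))

  c∘mS : ∀ X → η c X ∘ η m (F₀ S X) ≡ η c X ∘ F₁ Ran (η c X)
  c∘mS X = trans (proj₁ (proj₂ (isRan (Ran ∘F Ran) (c ∘ᵥ (Ran ▸ c) ∘ᵥ FEq⇒ (assocF Ran Ran S)))) X)
                 (cong (η c X ∘_) identityʳ)

  private
    module _ (X : Obj A) where
      SX : Obj E
      SX = F₀ S X

      cX : Hom E (F₀ Ran SX) SX
      cX = η c X

      identityˡ-under-c : cX ∘ (η m SX ∘ F₁ Ran (η u SX)) ≡ cX ∘ id
      identityˡ-under-c = begin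
        cX ∘ (η m SX ∘ F₁ Ran (η u SX))          ≡⟨ pullˡ (c∘mS X) ⟩
        (cX ∘ F₁ Ran cX) ∘ F₁ Ran (η u SX)       ≡⟨ trans assoc (cong (cX ∘_) (sym (homomorphism Ran))) ⟩
        cX ∘ F₁ Ran (cX ∘ η u SX)                ≡⟨ cong (λ f → cX ∘ F₁ Ran f) (c∘uS X) ⟩
        cX ∘ F₁ Ran id                           ≡⟨ cong (cX ∘_) (identity Ran) ⟩
        cX ∘ id                                  ∎

      identityʳ-under-c : cX ∘ (η m SX ∘ η u (F₀ Ran SX)) ≡ cX ∘ id
      identityʳ-under-c = begin
        cX ∘ (η m SX ∘ η u (F₀ Ran SX))          ≡⟨ pullˡ (c∘mS X) ⟩
        (cX ∘ F₁ Ran cX) ∘ η u (F₀ Ran SX)       ≡⟨ assoc ⟩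
        cX ∘ (F₁ Ran cX ∘ η u (F₀ Ran SX))       ≡⟨ cong (cX ∘_) (sym (commute u cX)) ⟩
        cX ∘ (η u SX ∘ cX)                       ≡⟨ pullˡ (c∘uS X) ⟩
        id ∘ cX                                  ≡⟨ id-comm cX ⟩
        cX ∘ id                                  ∎

      assoc-under-c : cX ∘ (η m SX ∘ F₁ Ran (η m SX)) ≡ cX ∘ (η m SX ∘ η m (F₀ Ran SX))
      assoc-under-c = begin
        cX ∘ (η m SX ∘ F₁ Ran (η m SX))                ≡⟨ pullˡ (c∘mS X) ⟩
        (cX ∘ F₁ Ran cX) ∘ F₁ Ran (η m SX)             ≡⟨ trans assoc (cong (cX ∘_) (sym (homomorphism Ran))) ⟩
        cX ∘ F₁ Ran (cX ∘ η m SX)                      ≡⟨ cong (λ f → cX ∘ F₁ Ran f) (c∘mS X) ⟩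
        cX ∘ F₁ Ran (cX ∘ F₁ Ran cX)                   ≡⟨ trans (cong (cX ∘_) (homomorphism Ran)) (sym assoc) ⟩
        (cX ∘ F₁ Ran cX) ∘ F₁ Ran (F₁ Ran cX)          ≡⟨ pushˡ (sym (c∘mS X)) ⟩
        cX ∘ (η m SX ∘ F₁ Ran (F₁ Ran cX))             ≡⟨ cong (cX ∘_) (commute m cX) ⟩
        cX ∘ (F₁ Ran cX ∘ η m (F₀ Ran SX))             ≡⟨ pullˡ (sym (c∘mS X)) ⟩
        (cX ∘ η m SX) ∘ η m (F₀ Ran SX)                ≡⟨ assoc ⟩
        cX ∘ (η m SX ∘ η m (F₀ Ran SX))                ∎

  isMonad : IsMonad Ran u m
  isMonad = record
    { identityˡ = ran-unique c isRan (m ∘ᵥ (Ran ▸ u)) idN identityˡ-under-c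
    ; identityʳ = ran-unique c isRan (dom-unitˡ (m ∘ᵥ (u ◂ Ran))) idN identityʳ-under-c
    ; assoc = ran-unique c isRan (m ∘ᵥ (Ran ▸ m)) (dom-assoc {F = Ran} {Ran} {Ran} (m ∘ᵥ (m ◂ Ran))) assoc-under-c
    }

module MonadMorphismLaws {E : Category o ℓ}
         {T' Q : Functor E E} (η' : NatTrans idF T') (μ' : NatTrans (T' ∘F T') T')
         {u : NatTrans idF Q} {m : NatTrans (Q ∘F Q) Q} (Q-isMonad : IsMonad Q u m)
         (σ : NatTrans T' Q) (σ∘η'≈u : σ ∘ᵥ η' ≈N u)
         (σ∘μ'≈m∘σσ : σ ∘ᵥ μ' ≈N m ∘ᵥ (σ ◂ Q) ∘ᵥ (T' ▸ σ)) where
  open Category E hiding (Obj; Hom)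
  open CategoryReasoning E
  module Q = IsMonad Q-isMonad
  open ≡-Reasoning

  private
    σ∘μ'∘ : ∀ X {W} (g : Hom E W (F₀ T' (F₀ T' X))) →
            η σ X ∘ (η μ' X ∘ g) ≡ η m X ∘ (η σ (F₀ Q X) ∘ (F₁ T' (η σ X) ∘ g))
    σ∘μ'∘ X g = trans (pullˡ (σ∘μ'≈m∘σσ X)) (trans assoc (cong (η m X ∘_) assoc))

  σ-identityˡ : ∀ X → η σ X ∘ (η μ' X ∘ F₁ T' (η η' X)) ≡ η σ X ∘ id
  σ-identityˡ X = begin
    η σ X ∘ (η μ' X ∘ F₁ T' (η η' X))                     ≡⟨ σ∘μ'∘ X _ ⟩
    η m X ∘ (η σ (F₀ Q X) ∘ (F₁ T' (η σ X) ∘ F₁ T' (η η' X)))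
      ≡⟨ cong (λ f → η m X ∘ (η σ (F₀ Q X) ∘ f)) (sym (homomorphism T')) ⟩
    η m X ∘ (η σ (F₀ Q X) ∘ F₁ T' (η σ X ∘ η η' X))       ≡⟨ cong (λ f → η m X ∘ (η σ (F₀ Q X) ∘ F₁ T' f)) (σ∘η'≈u X) ⟩
    η m X ∘ (η σ (F₀ Q X) ∘ F₁ T' (η u X))                ≡⟨ cong (η m X ∘_) (commute σ (η u X)) ⟩
    η m X ∘ (F₁ Q (η u X) ∘ η σ X)                        ≡⟨ pullˡ (Q.identityˡ X) ⟩
    id ∘ η σ X                                            ≡⟨ id-comm (η σ X) ⟩
    η σ X ∘ id                                            ∎

  σ-identityʳ : ∀ X → η σ X ∘ (η μ' X ∘ η η' (F₀ T' X)) ≡ η σ X ∘ id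
  σ-identityʳ X = begin
    η σ X ∘ (η μ' X ∘ η η' (F₀ T' X))                     ≡⟨ σ∘μ'∘ X _ ⟩
    η m X ∘ (η σ (F₀ Q X) ∘ (F₁ T' (η σ X) ∘ η η' (F₀ T' X)))
      ≡⟨ cong (λ f → η m X ∘ (η σ (F₀ Q X) ∘ f)) (sym (commute η' (η σ X))) ⟩
    η m X ∘ (η σ (F₀ Q X) ∘ (η η' (F₀ Q X) ∘ η σ X))      ≡⟨ cong (η m X ∘_) (pullˡ (σ∘η'≈u (F₀ Q X))) ⟩
    η m X ∘ (η u (F₀ Q X) ∘ η σ X)                        ≡⟨ pullˡ (Q.identityʳ X) ⟩
    id ∘ η σ X                                            ≡⟨ id-comm (η σ X) ⟩
    η σ X ∘ id                                            ∎

  σ-assoc : ∀ X → η σ X ∘ (η μ' X ∘ F₁ T' (η μ' X)) ≡ η σ X ∘ (η μ' X ∘ η μ' (F₀ T' X))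
  σ-assoc X = trans left (sym right)
    where
    σσσ : Hom E (F₀ T' (F₀ T' (F₀ T' X))) (F₀ Q (F₀ Q (F₀ Q X)))
    σσσ = η σ (F₀ Q (F₀ Q X)) ∘ (F₁ T' (η σ (F₀ Q X)) ∘ F₁ T' (F₁ T' (η σ X)))

    left : η σ X ∘ (η μ' X ∘ F₁ T' (η μ' X)) ≡ (η m X ∘ F₁ Q (η m X)) ∘ σσσ
    left = begin
      η σ X ∘ (η μ' X ∘ F₁ T' (η μ' X))                     ≡⟨ σ∘μ'∘ X _ ⟩
      η m X ∘ (η σ (F₀ Q X) ∘ (F₁ T' (η σ X) ∘ F₁ T' (η μ' X)))
        ≡⟨ cong (λ f → η m X ∘ (η σ (F₀ Q X) ∘ f)) (sym (homomorphism T')) ⟩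
      η m X ∘ (η σ (F₀ Q X) ∘ F₁ T' (η σ X ∘ η μ' X))
        ≡⟨ cong (λ f → η m X ∘ (η σ (F₀ Q X) ∘ F₁ T' f)) (σ∘μ'≈m∘σσ X) ⟩
      η m X ∘ (η σ (F₀ Q X) ∘ F₁ T' (η m X ∘ (η σ (F₀ Q X) ∘ F₁ T' (η σ X))))
        ≡⟨ cong (λ f → η m X ∘ (η σ (F₀ Q X) ∘ f))
                (trans (homomorphism T') (cong (F₁ T' (η m X) ∘_) (homomorphism T'))) ⟩
      η m X ∘ (η σ (F₀ Q X) ∘ (F₁ T' (η m X) ∘ (F₁ T' (η σ (F₀ Q X)) ∘ F₁ T' (F₁ T' (η σ X)))))
        ≡⟨ cong (η m X ∘_) (pullˡ (commute σ (η m X))) ⟩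
      η m X ∘ ((F₁ Q (η m X) ∘ η σ (F₀ Q (F₀ Q X))) ∘ (F₁ T' (η σ (F₀ Q X)) ∘ F₁ T' (F₁ T' (η σ X))))
        ≡⟨ trans (cong (η m X ∘_) assoc) (sym assoc) ⟩
      (η m X ∘ F₁ Q (η m X)) ∘ σσσ                          ∎

    right : η σ X ∘ (η μ' X ∘ η μ' (F₀ T' X)) ≡ (η m X ∘ F₁ Q (η m X)) ∘ σσσ
    right = begin
      η σ X ∘ (η μ' X ∘ η μ' (F₀ T' X))                     ≡⟨ σ∘μ'∘ X _ ⟩
      η m X ∘ (η σ (F₀ Q X) ∘ (F₁ T' (η σ X) ∘ η μ' (F₀ T' X)))
        ≡⟨ cong (λ f → η m X ∘ (η σ (F₀ Q X) ∘ f)) (sym (commute μ' (η σ X))) ⟩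
      η m X ∘ (η σ (F₀ Q X) ∘ (η μ' (F₀ Q X) ∘ F₁ T' (F₁ T' (η σ X))))
        ≡⟨ cong (η m X ∘_) (σ∘μ'∘ (F₀ Q X) _) ⟩
      η m X ∘ (η m (F₀ Q X) ∘ σσσ)                          ≡⟨ sym assoc ⟩
      (η m X ∘ η m (F₀ Q X)) ∘ σσσ                          ≡⟨ cong (_∘ σσσ) (sym (Q.assoc X)) ⟩
      (η m X ∘ F₁ Q (η m X)) ∘ σσσ                          ∎

module LiftingLaws {E : Category o ℓ} {B : Category o' ℓ'} (M : Monad B) (p : Functor E B)
         {T' : Functor E E} (pT'=Tp : FEq (p ∘F T') (Monad.T M ∘F p))
         {η' : NatTrans idF T'} {μ' : NatTrans (T' ∘F T') T'}
         (η'-over : UnitOver M p T' pT'=Tp η') (μ'-over : MultOver M p T' pT'=Tp μ') where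
  private
    module E = Category E
    open Category B hiding (Obj; Hom)
    open CategoryReasoning B
    open Monad M
    module M = IsMonad isMonad
    open ≡-Reasoning

    ι : ∀ X → Hom B (F₀ p (F₀ T' X)) (F₀ T (F₀ p X))
    ι X = ≡⇒Hom (eq₀ pT'=Tp X)

    ι∘pμ'∘ : ∀ X {W} (g : Hom E W (F₀ T' (F₀ T' X))) →
             ι X ∘ F₁ p (η μ' X E.∘ g) ≡ η mult (F₀ p X) ∘ (F₁ T (ι X) ∘ (ι (F₀ T' X) ∘ F₁ p g))
    ι∘pμ'∘ X g = begin
      ι X ∘ F₁ p (η μ' X E.∘ g)       ≡⟨ cong (ι X ∘_) (homomorphism p) ⟩
      ι X ∘ (F₁ p (η μ' X) ∘ F₁ p g)  ≡⟨ pullˡ (μ'-over X) ⟩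
      (η mult (F₀ p X) ∘ (F₁ T (ι X) ∘ ι (F₀ T' X))) ∘ F₁ p g
        ≡⟨ trans assoc (cong (η mult (F₀ p X) ∘_) assoc) ⟩
      η mult (F₀ p X) ∘ (F₁ T (ι X) ∘ (ι (F₀ T' X) ∘ F₁ p g)) ∎

    ι∘pid : ∀ X → ι X ≡ ι X ∘ F₁ p E.id
    ι∘pid X = trans (sym identityʳ) (cong (ι X ∘_) (sym (identity p)))

  p-identityˡ : ∀ X → F₁ p (η μ' X E.∘ F₁ T' (η η' X)) ≡ F₁ p E.id
  p-identityˡ X = ≡⇒Hom-cancelˡ (eq₀ pT'=Tp X) (begin
    ι X ∘ F₁ p (η μ' X E.∘ F₁ T' (η η' X))                          ≡⟨ ι∘pμ'∘ X _ ⟩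
    η mult (F₀ p X) ∘ (F₁ T (ι X) ∘ (ι (F₀ T' X) ∘ F₁ p (F₁ T' (η η' X))))
      ≡⟨ cong (λ f → η mult (F₀ p X) ∘ (F₁ T (ι X) ∘ f)) (eq₁ pT'=Tp (η η' X)) ⟩
    η mult (F₀ p X) ∘ (F₁ T (ι X) ∘ (F₁ T (F₁ p (η η' X)) ∘ ι X))
      ≡⟨ cong (η mult (F₀ p X) ∘_) (pullˡ (sym (homomorphism T))) ⟩
    η mult (F₀ p X) ∘ (F₁ T (ι X ∘ F₁ p (η η' X)) ∘ ι X)
      ≡⟨ cong (λ f → η mult (F₀ p X) ∘ (F₁ T f ∘ ι X)) (η'-over X) ⟩
    η mult (F₀ p X) ∘ (F₁ T (η unit (F₀ p X)) ∘ ι X)                ≡⟨ pullˡ (M.identityˡ (F₀ p X)) ⟩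
    id ∘ ι X                                                        ≡⟨ trans identityˡ (ι∘pid X) ⟩
    ι X ∘ F₁ p E.id                                                 ∎)

  p-identityʳ : ∀ X → F₁ p (η μ' X E.∘ η η' (F₀ T' X)) ≡ F₁ p E.id
  p-identityʳ X = ≡⇒Hom-cancelˡ (eq₀ pT'=Tp X) (begin
    ι X ∘ F₁ p (η μ' X E.∘ η η' (F₀ T' X))                          ≡⟨ ι∘pμ'∘ X _ ⟩
    η mult (F₀ p X) ∘ (F₁ T (ι X) ∘ (ι (F₀ T' X) ∘ F₁ p (η η' (F₀ T' X))))
      ≡⟨ cong (λ f → η mult (F₀ p X) ∘ (F₁ T (ι X) ∘ f)) (η'-over (F₀ T' X)) ⟩
    η mult (F₀ p X) ∘ (F₁ T (ι X) ∘ η unit (F₀ p (F₀ T' X)))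
      ≡⟨ cong (η mult (F₀ p X) ∘_) (sym (commute unit (ι X))) ⟩
    η mult (F₀ p X) ∘ (η unit (F₀ T (F₀ p X)) ∘ ι X)               ≡⟨ pullˡ (M.identityʳ (F₀ p X)) ⟩
    id ∘ ι X                                                        ≡⟨ trans identityˡ (ι∘pid X) ⟩
    ι X ∘ F₁ p E.id                                                 ∎)

  p-assoc : ∀ X → F₁ p (η μ' X E.∘ F₁ T' (η μ' X)) ≡ F₁ p (η μ' X E.∘ η μ' (F₀ T' X))
  p-assoc X = ≡⇒Hom-cancelˡ (eq₀ pT'=Tp X) (trans left (sym right))
    where
    μX : Hom B (F₀ T (F₀ T (F₀ p X))) (F₀ T (F₀ p X))
    μX = η mult (F₀ p X)

    ιιι : Hom B (F₀ p (F₀ T' (F₀ T' (F₀ T' X)))) (F₀ T (F₀ T (F₀ T (F₀ p X))))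
    ιιι = F₁ T (F₁ T (ι X)) ∘ (F₁ T (ι (F₀ T' X)) ∘ ι (F₀ T' (F₀ T' X)))

    left : ι X ∘ F₁ p (η μ' X E.∘ F₁ T' (η μ' X)) ≡ (μX ∘ η mult (F₀ T (F₀ p X))) ∘ ιιι
    left = begin
      ι X ∘ F₁ p (η μ' X E.∘ F₁ T' (η μ' X))                        ≡⟨ ι∘pμ'∘ X _ ⟩
      μX ∘ (F₁ T (ι X) ∘ (ι (F₀ T' X) ∘ F₁ p (F₁ T' (η μ' X))))
        ≡⟨ cong (λ f → μX ∘ (F₁ T (ι X) ∘ f)) (eq₁ pT'=Tp (η μ' X)) ⟩
      μX ∘ (F₁ T (ι X) ∘ (F₁ T (F₁ p (η μ' X)) ∘ ι (F₀ T' (F₀ T' X))))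
        ≡⟨ cong (μX ∘_) (pullˡ (sym (homomorphism T))) ⟩
      μX ∘ (F₁ T (ι X ∘ F₁ p (η μ' X)) ∘ ι (F₀ T' (F₀ T' X)))
        ≡⟨ cong (λ f → μX ∘ (F₁ T f ∘ ι (F₀ T' (F₀ T' X)))) (μ'-over X) ⟩
      μX ∘ (F₁ T (μX ∘ (F₁ T (ι X) ∘ ι (F₀ T' X))) ∘ ι (F₀ T' (F₀ T' X)))
        ≡⟨ cong (λ f → μX ∘ (f ∘ ι (F₀ T' (F₀ T' X))))
                (trans (homomorphism T) (cong (F₁ T μX ∘_) (homomorphism T))) ⟩
      μX ∘ ((F₁ T μX ∘ (F₁ T (F₁ T (ι X)) ∘ F₁ T (ι (F₀ T' X)))) ∘ ι (F₀ T' (F₀ T' X)))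
        ≡⟨ cong (μX ∘_) (trans assoc (cong (F₁ T μX ∘_) assoc)) ⟩
      μX ∘ (F₁ T μX ∘ ιιι)                                           ≡⟨ sym assoc ⟩
      (μX ∘ F₁ T μX) ∘ ιιι                                           ≡⟨ cong (_∘ ιιι) (M.assoc (F₀ p X)) ⟩
      (μX ∘ η mult (F₀ T (F₀ p X))) ∘ ιιι                            ∎

    right : ι X ∘ F₁ p (η μ' X E.∘ η μ' (F₀ T' X)) ≡ (μX ∘ η mult (F₀ T (F₀ p X))) ∘ ιιι
    right = begin
      ι X ∘ F₁ p (η μ' X E.∘ η μ' (F₀ T' X))                        ≡⟨ ι∘pμ'∘ X _ ⟩
      μX ∘ (F₁ T (ι X) ∘ (ι (F₀ T' X) ∘ F₁ p (η μ' (F₀ T' X))))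
        ≡⟨ cong (λ f → μX ∘ (F₁ T (ι X) ∘ f)) (μ'-over (F₀ T' X)) ⟩
      μX ∘ (F₁ T (ι X) ∘ (η mult (F₀ p (F₀ T' X)) ∘ (F₁ T (ι (F₀ T' X)) ∘ ι (F₀ T' (F₀ T' X)))))
        ≡⟨ cong (μX ∘_) (pullˡ (sym (commute mult (ι X)))) ⟩
      μX ∘ ((η mult (F₀ T (F₀ p X)) ∘ F₁ T (F₁ T (ι X))) ∘ (F₁ T (ι (F₀ T' X)) ∘ ι (F₀ T' (F₀ T' X))))
        ≡⟨ trans (cong (μX ∘_) assoc) (sym assoc) ⟩
      (μX ∘ η mult (F₀ T (F₀ p X))) ∘ ιιι                            ∎

cartesian-reflects-isMonad :
  {E : Category o ℓ} {B : Category o' ℓ'} (M : Monad B) (p : Functor E B)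
  {T' : Functor E E} (pT'=Tp : FEq (p ∘F T') (Monad.T M ∘F p))
  {η' : NatTrans idF T'} {μ' : NatTrans (T' ∘F T') T'} →
  UnitOver M p T' pT'=Tp η' → MultOver M p T' pT'=Tp μ' →
  {Q : Functor E E} {u : NatTrans idF Q} {m : NatTrans (Q ∘F Q) Q} → IsMonad Q u m →
  (σ : NatTrans T' Q) → IsCartesianNT p σ →
  σ ∘ᵥ η' ≈N u → σ ∘ᵥ μ' ≈N m ∘ᵥ (σ ◂ Q) ∘ᵥ (T' ▸ σ) →
  IsMonad T' η' μ'
cartesian-reflects-isMonad M p {T'} pT'=Tp {η'} {μ'} η'-over μ'-over Q-isMonad σ cart σ∘η'≈u σ∘μ'≈m∘σσ =
  record
    { identityˡ = cartesian-unique p σ cart (μ' ∘ᵥ (T' ▸ η')) idN p-identityˡ σ-identityˡ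
    ; identityʳ = cartesian-unique p σ cart (dom-unitˡ (μ' ∘ᵥ (η' ◂ T'))) idN p-identityʳ σ-identityʳ
    ; assoc = cartesian-unique p σ cart (μ' ∘ᵥ (T' ▸ μ'))
                (dom-assoc {F = T'} {T'} {T'} (μ' ∘ᵥ (μ' ◂ T'))) p-assoc σ-assoc
    }
  where
  open LiftingLaws M p pT'=Tp {η'} {μ'} η'-over μ'-over
  open MonadMorphismLaws η' μ' Q-isMonad σ σ∘η'≈u σ∘μ'≈m∘σσ

theorem3p5 : ∀ {oa ℓa ob ℓb oe ℓe}
    {A : Category oa ℓa} {B : Category ob ℓb} {E : Category oe ℓe}
    -- p : E → B a fibration, M = (T, η, μ) a monad on B
    (p : Functor E B) → IsFibration p →
    (M : Monad B) →
    -- lifting parameter R : A → B_T, S : A → E with KR = pS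
    (R : Functor A (Kleisli.Kl M)) (S : Functor A E) →
    (KR=pS : FEq (Kleisli.K M ∘F R) (p ∘F S)) →
    -- codensity condition: Ran_S S exists and p preserves it
    (Ran : Functor E E) (c : NatTrans (Ran ∘F S) S) (isRan : IsRan S S Ran c) →
    (pres : Preserved.Preserves p S Ran c) →
    -- σ : T^⊤⊤ → Ran_S S a cartesian lifting of the overline of K ε R
    (Ttt : Functor E E) (σ : NatTrans Ttt Ran) →
    (pT=Tp : FEq (p ∘F Ttt) (Monad.T M ∘F p)) →
    p ▸ σ ≈N Preserved.overline p S Ran c pres (KεR.KεR' M p R S KR=pS) ∘ᵥ FEq⇒ pT=Tp →
    IsCartesianNT p σ →
    -- η^⊤⊤ above η p with σ • η^⊤⊤ = u
    (ηtt : NatTrans idF Ttt) → UnitOver M p Ttt pT=Tp ηtt →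
    σ ∘ᵥ ηtt ≈N Codensity.u S Ran c isRan →
    -- μ^⊤⊤ above μ p with σ • μ^⊤⊤ = m • σ(Ran_S S) • T^⊤⊤σ
    (μtt : NatTrans (Ttt ∘F Ttt) Ttt) → MultOver M p Ttt pT=Tp μtt →
    σ ∘ᵥ μtt ≈N Codensity.m S Ran c isRan ∘ᵥ (σ ◂ Ran) ∘ᵥ (Ttt ▸ σ) →
    -- conclusion: a monad on E, lifting M along p
    IsMonad Ttt ηtt μtt × IsLifting M p Ttt ηtt μtt
theorem3p5 p _ M _ S _ Ran c isRan _ Ttt σ pT=Tp _ cart ηtt ηtt-over σ∘ηtt≈u μtt μtt-over σ∘μtt≈m∘σσ =
  cartesian-reflects-isMonad M p pT=Tp ηtt-over μtt-over (CodensityMonad.isMonad S Ran c isRan)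
    σ cart σ∘ηtt≈u σ∘μtt≈m∘σσ
  , record { pT'=Tp = pT=Tp ; η-over = ηtt-over ; μ-over = μtt-over }
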